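{- For every integer $k \geq 1$ there exists a $(2k-1)$-sphere with chromatic number $3k$, and there exists a $(2k)$-sphere with chromatic number $3k+1$.
   Context: All graphs are finite simple graphs. For a vertex $x$ of a graph $G$, the unit sphere $S(x)$ is the subgraph induced by the neighbors of $x$; $G-x$ is the subgraph induced by the remaining vertices. The one-point graph is contractible, and a graph $G$ is contractible if it has a vertex $x$ with $S(x)$ and $G-x$ both contractible. The empty graph is the $(-1)$-sphere. For $d\ge 0$, a $d$-manifold is a finite simple graph in which every unit sphere is a $(d-1)$-sphere, and a $d$-sphere is a $d$-manifold $G$ with a vertex $x$ such that $G-x$ is contractible. The chromatic number is the minimal number of colors in a proper vertex coloring. -}

module Defs where

open import Data.Nat using (ℕ; zero; suc; _<_)
open import Data.Bool using (Bool; true; false; if_then_else_)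
open import Data.Fin using (Fin)
open import Data.Fin.Subset using (Subset; inside; outside; ⁅_⁆; _∈_; _∩_; _-_; ⊤) renaming (⊥ to ∅)
open import Data.Vec using (tabulate)
open import Data.Product using (Σ; ∃; _×_)
open import Relation.Binary.PropositionalEquality using (_≡_; _≢_)
open import Relation.Nullary using (¬_)

record Graph : Set where
  field
    n      : ℕ
    adj    : Fin n → Fin n → Bool
    sym    : ∀ x y → adj x y ≡ adj y x
    irrefl : ∀ x → adj x x ≡ false

module _ (G : Graph) where
  open Graph G

  N : Fin n → Subset n
  N x = tabulate (λ y → if adj x y then inside else outside)

  -- All notions below refer to induced subgraphs of G, given by vertex subsets U.
  -- The unit sphere of x in G[U] is G[U ∩ N x]; G[U] - x is G[U - x].

  -- Contractibility of the induced subgraph G[U] (inductive reading of the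
  -- recursive definition).
  data Contractible : Subset n → Set where
    point : ∀ {U} x → U ≡ ⁅ x ⁆ → Contractible U
    step  : ∀ {U} x → x ∈ U → Contractible (U ∩ N x) → Contractible (U - x)
          → Contractible U

  -- Sphere′ m U : G[U] is an (m-1)-sphere (shifted index, so m = 0 is the
  -- (-1)-sphere, i.e. the empty graph).
  -- Manifold′ m U : G[U] is an m-manifold (m ≥ 0), i.e. every unit sphere is
  -- an (m-1)-sphere.
  Sphere′ : ℕ → Subset n → Set
  Manifold′ : ℕ → Subset n → Set
  Manifold′ m U = ∀ x → x ∈ U → Sphere′ m (U ∩ N x)
  Sphere′ zero U = U ≡ ∅
  Sphere′ (suc d) U = Manifold′ d U × Σ (Fin n) (λ x → x ∈ U × Contractible (U - x))

  IsSphere : ℕ → Set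
  IsSphere d = Sphere′ (suc d) ⊤

  Colourable : ℕ → Set
  Colourable c = Σ (Fin n → Fin c) (λ f → ∀ x y → adj x y ≡ true → f x ≢ f y)

  ChromaticNumber : ℕ → Set
  ChromaticNumber c = Colourable c × (∀ c′ → c′ < c → ¬ Colourable c′)

-- The join A ⋆ B (disjoint union plus all edges between the two parts) of a p-sphere
-- and a q-sphere is a (p+q+1)-sphere: a unit sphere of the join is the join of a unit
-- sphere with the other factor, and deleting a vertex of A leaves the join of a
-- contractible graph with B, which collapses onto cones.  No colour can be used on both
-- sides of a join, so χ(A ⋆ B) = χ(A) + χ(B).  The 5-cycle is a 1-sphere with χ = 3 and
-- S⁰ is a 0-sphere with χ = 1; hence the k-fold join of C₅ is a (2k-1)-sphere with
-- χ = 3k, and its join with S⁰ is a 2k-sphere with χ = 3k + 1.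
module Submission where

open import Defs
open import Data.Nat using (ℕ; zero; suc; _<_; _≤_; _+_; _*_; _∸_)
open import Data.Nat.Properties using (+-suc; +-comm; *-comm; +-cancelˡ-<; m≤n⇒∃[o]m+o≡n)
open import Data.Nat.Induction using (<-wellFounded)
open import Data.Nat.DivMod using (_mod_)
open import Data.Bool using (Bool; true; false; if_then_else_; _∨_)
open import Data.Bool.Properties using (∨-comm) renaming (_≟_ to _≟ᵇ_)
open import Data.Fin using (Fin; zero; suc; #_; toℕ; _↑ˡ_; _↑ʳ_; splitAt; punchOut; _≟_)
open import Data.Fin.Properties
  using (splitAt-↑ˡ; splitAt-↑ʳ; ↑ˡ-injective; ↑ʳ-injective; punchOut-injective;
         suc-injective; 0≢1+n; injective⇒≤; all?)
open import Data.Fin.Subset using (Subset; inside; outside; ⁅_⁆; _∈_; _∉_; _∩_; _─_; _-_; ⊤; ∣_∣)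
  renaming (⊥ to ∅)
open import Data.Fin.Subset.Properties
  using (_∈?_; ∉⊥; p─⊥≡p; ∩-identityʳ; Empty-unique; nonempty?;
         p⊂q⇒∣p∣<∣q∣; p∩q⊆p; x∈p∩q⁻; x∈p⇒∣p-x∣<∣p∣)
open import Data.Vec using ([]; _∷_; here; there; _++_; lookup; tabulate; replicate)
open import Data.Vec.Properties using (lookup∘tabulate; tabulate-cong; zipWith-++; []=⇒lookup; ≡-dec)
open import Data.Sum using (_⊎_; inj₁; inj₂)
open import Data.Product using (Σ; _×_; _,_; proj₂)
open import Data.Empty using (⊥-elim)
open import Function using (_∘_)
open import Function.Definitions using (Injective)
open import Induction.WellFounded using (Acc; acc)
open import Relation.Binary.PropositionalEquality
  using (_≡_; _≢_; refl; sym; trans; cong; cong₂; subst; module ≡-Reasoning)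
open import Relation.Nullary using (¬_; yes; no)
open import Relation.Nullary.Decidable using (⌊_⌋; from-yes; _→-dec_; ¬?)

replicate-++ : ∀ {A : Set} m n (x : A) → replicate (m + n) x ≡ replicate m x ++ replicate n x
replicate-++ zero    n x = refl
replicate-++ (suc m) n x = cong (x ∷_) (replicate-++ m n x)

tabulate-const : ∀ {A : Set} n (x : A) → tabulate {n = n} (λ _ → x) ≡ replicate n x
tabulate-const zero    x = refl
tabulate-const (suc n) x = cong (x ∷_) (tabulate-const n x)

tabulate-++ : ∀ {A : Set} m {n} (f : Fin (m + n) → A) →
              tabulate f ≡ tabulate (f ∘ (_↑ˡ n)) ++ tabulate (f ∘ (m ↑ʳ_))
tabulate-++ zero    f = refl
tabulate-++ (suc m) f = cong (f zero ∷_) (tabulate-++ m (f ∘ suc))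

↑-elim : ∀ m {n} {P : Fin (m + n) → Set} →
         (∀ x → P (x ↑ˡ n)) → (∀ y → P (m ↑ʳ y)) → ∀ i → P i
↑-elim zero    left right i       = right i
↑-elim (suc m) left right zero    = left zero
↑-elim (suc m) left right (suc i) = ↑-elim m (left ∘ suc) right i

⁅↑ˡ⁆ : ∀ {m} n (x : Fin m) → ⁅ x ↑ˡ n ⁆ ≡ ⁅ x ⁆ ++ ∅ {n}
⁅↑ˡ⁆ {suc m} n zero    = cong (inside ∷_) (replicate-++ m n outside)
⁅↑ˡ⁆         n (suc x) = cong (outside ∷_) (⁅↑ˡ⁆ n x)

⁅↑ʳ⁆ : ∀ m {n} (y : Fin n) → ⁅ m ↑ʳ y ⁆ ≡ ∅ {m} ++ ⁅ y ⁆
⁅↑ʳ⁆ zero    y = refl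
⁅↑ʳ⁆ (suc m) y = cong (outside ∷_) (⁅↑ʳ⁆ m y)

↑ˡ≢↑ʳ : ∀ {m n} (x : Fin m) (y : Fin n) → x ↑ˡ n ≢ m ↑ʳ y
↑ˡ≢↑ʳ zero    y = λ ()
↑ˡ≢↑ʳ (suc x) y = ↑ˡ≢↑ʳ x y ∘ suc-injective

∩-++ : ∀ {m n} (U U′ : Subset m) (V V′ : Subset n) →
       (U ++ V) ∩ (U′ ++ V′) ≡ (U ∩ U′) ++ (V ∩ V′)
∩-++ U U′ V V′ = zipWith-++ _ U V U′ V′

─-++ : ∀ {m n} (U U′ : Subset m) (V V′ : Subset n) →
       (U ++ V) ─ (U′ ++ V′) ≡ (U ─ U′) ++ (V ─ V′)
─-++ U U′ V V′ = zipWith-++ _ U V U′ V′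

-↑ˡ-++ : ∀ {m n} (U : Subset m) (V : Subset n) x → (U ++ V) - (x ↑ˡ n) ≡ (U - x) ++ V
-↑ˡ-++ {m} {n} U V x = begin
  (U ++ V) ─ ⁅ x ↑ˡ n ⁆     ≡⟨ cong ((U ++ V) ─_) (⁅↑ˡ⁆ n x) ⟩
  (U ++ V) ─ (⁅ x ⁆ ++ ∅)   ≡⟨ ─-++ U ⁅ x ⁆ V ∅ ⟩
  (U - x) ++ (V ─ ∅)        ≡⟨ cong ((U - x) ++_) (p─⊥≡p V) ⟩
  (U - x) ++ V              ∎
  where open ≡-Reasoning

-↑ʳ-++ : ∀ {m n} (U : Subset m) (V : Subset n) y → (U ++ V) - (m ↑ʳ y) ≡ U ++ (V - y)
-↑ʳ-++ {m} {n} U V y = begin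
  (U ++ V) ─ ⁅ m ↑ʳ y ⁆     ≡⟨ cong ((U ++ V) ─_) (⁅↑ʳ⁆ m y) ⟩
  (U ++ V) ─ (∅ ++ ⁅ y ⁆)   ≡⟨ ─-++ U ∅ V ⁅ y ⁆ ⟩
  (U ─ ∅) ++ (V - y)        ≡⟨ cong (_++ (V - y)) (p─⊥≡p U) ⟩
  U ++ (V - y)              ∎
  where open ≡-Reasoning

∈-++⁺ˡ : ∀ {m n} {U : Subset m} {V : Subset n} {x} → x ∈ U → x ↑ˡ n ∈ U ++ V
∈-++⁺ˡ {x = zero}  here      = here
∈-++⁺ˡ {x = suc x} (there p) = there (∈-++⁺ˡ p)

∈-++⁺ʳ : ∀ {m n} (U : Subset m) {V : Subset n} {y} → y ∈ V → m ↑ʳ y ∈ U ++ V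
∈-++⁺ʳ []      p = p
∈-++⁺ʳ (u ∷ U) p = there (∈-++⁺ʳ U p)

∈-++⁻ˡ : ∀ {m n} {U : Subset m} {V : Subset n} {x} → x ↑ˡ n ∈ U ++ V → x ∈ U
∈-++⁻ˡ {U = u ∷ U} {x = zero}  here      = here
∈-++⁻ˡ {U = u ∷ U} {x = suc x} (there p) = there (∈-++⁻ˡ p)

∈-++⁻ʳ : ∀ {m n} (U : Subset m) {V : Subset n} {y} → m ↑ʳ y ∈ U ++ V → y ∈ V
∈-++⁻ʳ []      p         = p
∈-++⁻ʳ (u ∷ U) (there p) = ∈-++⁻ʳ U p

N-irrefl : ∀ G x → x ∉ N G x
N-irrefl G x x∈N[x] with () ← trans (sym ([]=⇒lookup x∈N[x]))
  (trans (lookup∘tabulate _ x) (cong (λ t → if t then inside else outside) (Graph.irrefl G x)))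

Proper : (G : Graph) {c : ℕ} → (Fin (Graph.n G) → Fin c) → Set
Proper G f = ∀ x y → Graph.adj G x y ≡ true → f x ≢ f y

-- A form of χ(G) ≥ m that, unlike ¬ Colourable, passes through a join.
ForcesColours : Graph → ℕ → Set
ForcesColours G m = ∀ {c} (f : Fin (Graph.n G) → Fin c) → Proper G f →
                    Σ (Fin m → Fin (Graph.n G)) λ v → Injective _≡_ _≡_ (f ∘ v)

removeColours : ∀ (G : Graph) m {c} (f : Fin (Graph.n G) → Fin (m + c)) → Proper G f →
                (e : Fin m → Fin (m + c)) → Injective _≡_ _≡_ e → (∀ x i → f x ≢ e i) →
                Colourable G c
removeColours G zero    f f-proper _ _     _      = f , f-proper
removeColours G (suc m) f f-proper e e-inj avoids =
  removeColours G m (λ x → punchOut (e₀≢f x)) f′-proper (λ i → punchOut (e₀≢e i)) e′-inj avoids′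
  where
  e₀≢f : ∀ x → e zero ≢ f x
  e₀≢f x = avoids x zero ∘ sym
  e₀≢e : ∀ i → e zero ≢ e (suc i)
  e₀≢e i = 0≢1+n ∘ e-inj
  f′-proper : Proper G (λ x → punchOut (e₀≢f x))
  f′-proper x y xy = f-proper x y xy ∘ punchOut-injective (e₀≢f x) (e₀≢f y)
  e′-inj : Injective _≡_ _≡_ (λ i → punchOut (e₀≢e i))
  e′-inj {i} {j} = suc-injective ∘ e-inj ∘ punchOut-injective (e₀≢e i) (e₀≢e j)
  avoids′ : ∀ x i → punchOut (e₀≢f x) ≢ punchOut (e₀≢e i)
  avoids′ x i = avoids x (suc i) ∘ punchOut-injective (e₀≢f x) (e₀≢e i)

module _ (A B : Graph) where
  private
    module A = Graph A
    module B = Graph B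

  adj-⊎ : Fin A.n ⊎ Fin B.n → Fin A.n ⊎ Fin B.n → Bool
  adj-⊎ (inj₁ x) (inj₁ y) = A.adj x y
  adj-⊎ (inj₂ x) (inj₂ y) = B.adj x y
  adj-⊎ _        _        = true

  adj-⊎-sym : ∀ u v → adj-⊎ u v ≡ adj-⊎ v u
  adj-⊎-sym (inj₁ x) (inj₁ y) = A.sym x y
  adj-⊎-sym (inj₂ x) (inj₂ y) = B.sym x y
  adj-⊎-sym (inj₁ x) (inj₂ y) = refl
  adj-⊎-sym (inj₂ x) (inj₁ y) = refl

  adj-⊎-irrefl : ∀ u → adj-⊎ u u ≡ false
  adj-⊎-irrefl (inj₁ x) = A.irrefl x
  adj-⊎-irrefl (inj₂ x) = B.irrefl x

_⋆_ : Graph → Graph → Graph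
A ⋆ B = record
  { n      = Graph.n A + Graph.n B
  ; adj    = λ i j → adj-⊎ A B (split i) (split j)
  ; sym    = λ i j → adj-⊎-sym A B (split i) (split j)
  ; irrefl = λ i → adj-⊎-irrefl A B (split i)
  }
  where
  split : Fin (Graph.n A + Graph.n B) → Fin (Graph.n A) ⊎ Fin (Graph.n B)
  split = splitAt (Graph.n A)

module _ (A B : Graph) where
  private
    a = Graph.n A
    b = Graph.n B
    J = A ⋆ B
    adj = Graph.adj J

  adj-↑ˡ-↑ˡ : ∀ x y → adj (x ↑ˡ b) (y ↑ˡ b) ≡ Graph.adj A x y
  adj-↑ˡ-↑ˡ x y = cong₂ (adj-⊎ A B) (splitAt-↑ˡ a x b) (splitAt-↑ˡ a y b)

  adj-↑ʳ-↑ʳ : ∀ x y → adj (a ↑ʳ x) (a ↑ʳ y) ≡ Graph.adj B x y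
  adj-↑ʳ-↑ʳ x y = cong₂ (adj-⊎ A B) (splitAt-↑ʳ a b x) (splitAt-↑ʳ a b y)

  adj-↑ˡ-↑ʳ : ∀ x y → adj (x ↑ˡ b) (a ↑ʳ y) ≡ true
  adj-↑ˡ-↑ʳ x y = cong₂ (adj-⊎ A B) (splitAt-↑ˡ a x b) (splitAt-↑ʳ a b y)

  adj-↑ʳ-↑ˡ : ∀ y x → adj (a ↑ʳ y) (x ↑ˡ b) ≡ true
  adj-↑ʳ-↑ˡ y x = cong₂ (adj-⊎ A B) (splitAt-↑ʳ a b y) (splitAt-↑ˡ a x b)

  private
    side : Bool → Bool
    side t = if t then inside else outside

  N-↑ˡ : ∀ x → N J (x ↑ˡ b) ≡ N A x ++ ⊤
  N-↑ˡ x = trans (tabulate-++ a _) (cong₂ _++_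
    (tabulate-cong (cong side ∘ adj-↑ˡ-↑ˡ x))
    (trans (tabulate-cong (cong side ∘ adj-↑ˡ-↑ʳ x)) (tabulate-const b inside)))

  N-↑ʳ : ∀ y → N J (a ↑ʳ y) ≡ ⊤ ++ N B y
  N-↑ʳ y = trans (tabulate-++ a _) (cong₂ _++_
    (trans (tabulate-cong (cong side ∘ adj-↑ʳ-↑ˡ y)) (tabulate-const a inside))
    (tabulate-cong (cong side ∘ adj-↑ʳ-↑ʳ y)))

  ∩N-↑ˡ : ∀ (U : Subset a) (V : Subset b) x → (U ++ V) ∩ N J (x ↑ˡ b) ≡ (U ∩ N A x) ++ V
  ∩N-↑ˡ U V x = begin
    (U ++ V) ∩ N J (x ↑ˡ b)  ≡⟨ cong ((U ++ V) ∩_) (N-↑ˡ x) ⟩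
    (U ++ V) ∩ (N A x ++ ⊤)  ≡⟨ ∩-++ U (N A x) V ⊤ ⟩
    (U ∩ N A x) ++ (V ∩ ⊤)   ≡⟨ cong ((U ∩ N A x) ++_) (∩-identityʳ V) ⟩
    (U ∩ N A x) ++ V         ∎
    where open ≡-Reasoning

  ∩N-↑ʳ : ∀ (U : Subset a) (V : Subset b) y → (U ++ V) ∩ N J (a ↑ʳ y) ≡ U ++ (V ∩ N B y)
  ∩N-↑ʳ U V y = begin
    (U ++ V) ∩ N J (a ↑ʳ y)  ≡⟨ cong ((U ++ V) ∩_) (N-↑ʳ y) ⟩
    (U ++ V) ∩ (⊤ ++ N B y)  ≡⟨ ∩-++ U ⊤ V (N B y) ⟩
    (U ∩ ⊤) ++ (V ∩ N B y)   ≡⟨ cong (_++ (V ∩ N B y)) (∩-identityʳ U) ⟩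
    U ++ (V ∩ N B y)         ∎
    where open ≡-Reasoning

  Contractible-∅++ : ∀ {V} → Contractible B V → Contractible J (∅ ++ V)
  Contractible-∅++ (point y refl) = point (a ↑ʳ y) (sym (⁅↑ʳ⁆ a y))
  Contractible-∅++ {V} (step y y∈V S[y] V-y) =
    step (a ↑ʳ y) (∈-++⁺ʳ ∅ y∈V)
      (subst (Contractible J) (sym (∩N-↑ʳ ∅ V y)) (Contractible-∅++ S[y]))
      (subst (Contractible J) (sym (-↑ʳ-++ ∅ V y)) (Contractible-∅++ V-y))

  -- Peel off the vertices y of V: the unit sphere of y is again a cone with apex x.
  cone : ∀ x V → Contractible J (⁅ x ⁆ ++ V)
  cone x V = go V (<-wellFounded ∣ V ∣)
    where
    go : ∀ V → Acc _<_ ∣ V ∣ → Contractible J (⁅ x ⁆ ++ V)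
    go V (acc smaller) with nonempty? V
    ... | no V-empty =
      point (x ↑ˡ b) (trans (cong (⁅ x ⁆ ++_) (Empty-unique V-empty)) (sym (⁅↑ˡ⁆ b x)))
    ... | yes (y , y∈V) =
      step (a ↑ʳ y) (∈-++⁺ʳ ⁅ x ⁆ y∈V)
        (subst (Contractible J) (sym (∩N-↑ʳ ⁅ x ⁆ V y))
          (go (V ∩ N B y) (smaller ∣V∩N[y]∣<∣V∣)))
        (subst (Contractible J) (sym (-↑ʳ-++ ⁅ x ⁆ V y))
          (go (V - y) (smaller (x∈p⇒∣p-x∣<∣p∣ y∈V))))
      where
      ∣V∩N[y]∣<∣V∣ : ∣ V ∩ N B y ∣ < ∣ V ∣
      ∣V∩N[y]∣<∣V∣ = p⊂q⇒∣p∣<∣q∣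
        (p∩q⊆p V (N B y) , y , y∈V , N-irrefl B y ∘ proj₂ ∘ x∈p∩q⁻ V (N B y))

  Contractible-++ : ∀ {U} V → Contractible A U → Contractible J (U ++ V)
  Contractible-++ V (point x refl) = cone x V
  Contractible-++ {U} V (step x x∈U S[x] U-x) =
    step (x ↑ˡ b) (∈-++⁺ˡ x∈U)
      (subst (Contractible J) (sym (∩N-↑ˡ U V x)) (Contractible-++ V S[x]))
      (subst (Contractible J) (sym (-↑ˡ-++ U V x)) (Contractible-++ V U-x))

  Sphere′-∅++ : ∀ q {V} → Sphere′ B q V → Sphere′ J q (∅ ++ V)
  Sphere′-∅++ zero    refl = sym (replicate-++ a b outside)
  Sphere′-∅++ (suc q) {V} (V-manifold , y , y∈V , V-y) =
    manifold , a ↑ʳ y , ∈-++⁺ʳ ∅ y∈V ,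
    subst (Contractible J) (sym (-↑ʳ-++ ∅ V y)) (Contractible-∅++ V-y)
    where
    manifold : Manifold′ J q (∅ ++ V)
    manifold = ↑-elim a
      (λ x x∈ → ⊥-elim (∉⊥ (∈-++⁻ˡ x∈)))
      (λ z z∈ → subst (Sphere′ J q) (sym (∩N-↑ʳ ∅ V z))
                  (Sphere′-∅++ q (V-manifold z (∈-++⁻ʳ ∅ z∈))))

  Sphere′-++ : ∀ p q {U V} → Sphere′ A p U → Sphere′ B q V → Sphere′ J (p + q) (U ++ V)
  Sphere′-++ zero    q refl S-V = Sphere′-∅++ q S-V
  Sphere′-++ (suc p) q {U} {V} S-U@(U-manifold , x , x∈U , U-x) S-V =
    manifold , x ↑ˡ b , ∈-++⁺ˡ x∈U ,
    subst (Contractible J) (sym (-↑ˡ-++ U V x)) (Contractible-++ V U-x)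
    where
    unit-sphereʳ : ∀ q {V} y → Sphere′ B q V → y ∈ V → Sphere′ J (p + q) (U ++ (V ∩ N B y))
    unit-sphereʳ zero    y refl       y∈∅ = ⊥-elim (∉⊥ y∈∅)
    unit-sphereʳ (suc q) {V} y (V-manifold , _) y∈V =
      subst (λ d → Sphere′ J d (U ++ (V ∩ N B y))) (sym (+-suc p q))
        (Sphere′-++ (suc p) q S-U (V-manifold y y∈V))

    manifold : Manifold′ J (p + q) (U ++ V)
    manifold = ↑-elim a
      (λ x′ x′∈ → subst (Sphere′ J (p + q)) (sym (∩N-↑ˡ U V x′))
                    (Sphere′-++ p q (U-manifold x′ (∈-++⁻ˡ x′∈)) S-V))
      (λ y y∈ → subst (Sphere′ J (p + q)) (sym (∩N-↑ʳ U V y))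
                  (unit-sphereʳ q y S-V (∈-++⁻ʳ U y∈)))

  Sphere′-⋆ : ∀ {p q} → Sphere′ A p ⊤ → Sphere′ B q ⊤ → Sphere′ J (p + q) ⊤
  Sphere′-⋆ {p} {q} S-A S-B =
    subst (Sphere′ J (p + q)) (sym (replicate-++ a b inside)) (Sphere′-++ p q S-A S-B)

  Colourable-⋆ : ∀ {c₁ c₂} → Colourable A c₁ → Colourable B c₂ → Colourable J (c₁ + c₂)
  Colourable-⋆ {c₁} {c₂} (f , f-proper) (g , g-proper) =
    (λ i → colour (splitAt a i)) , λ i j → proper (splitAt a i) (splitAt a j)
    where
    colour : Fin a ⊎ Fin b → Fin (c₁ + c₂)
    colour (inj₁ x) = f x ↑ˡ c₂
    colour (inj₂ y) = c₁ ↑ʳ g y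

    proper : ∀ u v → adj-⊎ A B u v ≡ true → colour u ≢ colour v
    proper (inj₁ x) (inj₁ y) xy = f-proper x y xy ∘ ↑ˡ-injective c₂ _ _
    proper (inj₂ x) (inj₂ y) xy = g-proper x y xy ∘ ↑ʳ-injective c₁ _ _
    proper (inj₁ x) (inj₂ y) _ = ↑ˡ≢↑ʳ (f x) (g y)
    proper (inj₂ x) (inj₁ y) _ = ↑ˡ≢↑ʳ (f y) (g x) ∘ sym

  ¬Colourable-⋆ : ∀ {m d} → ForcesColours A m → (∀ c → c < d → ¬ Colourable B c) →
                  ∀ c → c < m + d → ¬ Colourable J c
  ¬Colourable-⋆ {m} {d} A-forces B-needs c c<m+d (f , f-proper)
    with A-forces (f ∘ (_↑ˡ b)) (λ x y → f-proper _ _ ∘ trans (adj-↑ˡ-↑ˡ x y))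
  ... | v , v-rainbow with m≤n⇒∃[o]m+o≡n (injective⇒≤ v-rainbow)
  ... | c′ , refl =
    B-needs c′ (+-cancelˡ-< m c′ d c<m+d)
      (removeColours B m (f ∘ (a ↑ʳ_)) (λ x y → f-proper _ _ ∘ trans (adj-↑ʳ-↑ʳ x y))
        (f ∘ (_↑ˡ b) ∘ v) v-rainbow
        (λ y i → f-proper _ _ (adj-↑ʳ-↑ˡ y (v i))))

  ChromaticNumber-⋆ : ∀ {m d} → Colourable A m → ForcesColours A m → ChromaticNumber B d →
                      ChromaticNumber J (m + d)
  ChromaticNumber-⋆ A-colourable A-forces (B-colourable , B-needs) =
    Colourable-⋆ A-colourable B-colourable , ¬Colourable-⋆ A-forces B-needs

EmptyGraph : Graph
EmptyGraph = record { n = 0 ; adj = λ () ; sym = λ () ; irrefl = λ () }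

_⋆^_ : Graph → ℕ → Graph
A ⋆^ zero  = EmptyGraph
A ⋆^ suc k = A ⋆ (A ⋆^ k)

Sphere′-⋆^ : ∀ {A p} k → Sphere′ A p ⊤ → Sphere′ (A ⋆^ k) (k * p) ⊤
Sphere′-⋆^     zero    _   = refl
Sphere′-⋆^ {A} (suc k) S-A = Sphere′-⋆ A (A ⋆^ k) S-A (Sphere′-⋆^ k S-A)

ChromaticNumber-⋆^ : ∀ {A m} k → Colourable A m → ForcesColours A m →
                     ChromaticNumber (A ⋆^ k) (k * m)
ChromaticNumber-⋆^     zero    _            _        = ((λ ()) , λ ()) , λ _ ()
ChromaticNumber-⋆^ {A} (suc k) A-colourable A-forces =
  ChromaticNumber-⋆ A (A ⋆^ k) A-colourable A-forces (ChromaticNumber-⋆^ k A-colourable A-forces)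

S⁰ : Graph
S⁰ = record { n = 2 ; adj = λ _ _ → false ; sym = λ _ _ → refl ; irrefl = λ _ → refl }

S⁰-sphere : Sphere′ S⁰ 1 ⊤
S⁰-sphere = (λ _ _ → refl) , # 0 , here , point (# 1) refl

S⁰-colourable : Colourable S⁰ 1
S⁰-colourable = (λ _ → zero) , λ _ _ ()

S⁰-forces : ForcesColours S⁰ 1
S⁰-forces f _ = (λ _ → zero) , λ { {zero} {zero} _ → refl }

next : Fin 5 → Fin 5
next i = suc (toℕ i) mod 5

prev : Fin 5 → Fin 5
prev i = (toℕ i + 4) mod 5

consecutive : Fin 5 → Fin 5 → Bool
consecutive i j = ⌊ j ≟ next i ⌋ ∨ ⌊ i ≟ next j ⌋

C₅ : Graph
C₅ = record
  { n      = 5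
  ; adj    = consecutive
  ; sym    = λ i j → ∨-comm ⌊ j ≟ next i ⌋ ⌊ i ≟ next j ⌋
  ; irrefl = from-yes (all? λ i → consecutive i i ≟ᵇ false)
  }

C₅-unit-sphere : ∀ x → Sphere′ C₅ 1 (⊤ ∩ N C₅ x)
C₅-unit-sphere x =
  from-yes (all? λ z → all? λ y → (y ∈? S z) →-dec ≡-dec _≟ᵇ_ (S z ∩ N C₅ y) ∅) x ,
  prev x , from-yes (all? λ z → prev z ∈? S z) x ,
  point (next x) (from-yes (all? λ z → ≡-dec _≟ᵇ_ (S z - prev z) ⁅ next z ⁆) x)
  where
  S : Fin 5 → Subset 5
  S x = ⊤ ∩ N C₅ x

-- Deleting vertex 0 leaves the path 1 – 2 – 3 – 4, which is collapsed from the left.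
C₅-sphere : Sphere′ C₅ 2 ⊤
C₅-sphere = (λ x _ → C₅-unit-sphere x) , # 0 , here ,
  step (# 1) (there here) (point (# 2) refl)
    (step (# 2) (there (there here)) (point (# 3) refl)
      (step (# 3) (there (there (there here))) (point (# 4) refl)
        (point (# 4) refl)))

C₅-colourable : Colourable C₅ 3
C₅-colourable = colour , from-yes (all? λ x → all? λ y →
                  (consecutive x y ≟ᵇ true) →-dec ¬? (colour x ≟ colour y))
  where
  colour : Fin 5 → Fin 3
  colour = lookup (# 0 ∷ # 1 ∷ # 0 ∷ # 1 ∷ # 2 ∷ [])

rainbow₃ : ∀ {X Y : Set} (f : X → Y) {u v w} → f u ≢ f v → f u ≢ f w → f v ≢ f w →
           Σ (Fin 3 → X) λ g → Injective _≡_ _≡_ (f ∘ g)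
rainbow₃ f {u} {v} {w} uv uw vw = lookup (u ∷ v ∷ w ∷ []) , injective
  where
  injective : Injective _≡_ _≡_ (f ∘ lookup (u ∷ v ∷ w ∷ []))
  injective {zero}             {zero}             _ = refl
  injective {suc zero}         {suc zero}         _ = refl
  injective {suc (suc zero)}   {suc (suc zero)}   _ = refl
  injective {zero}             {suc zero}         e = ⊥-elim (uv e)
  injective {zero}             {suc (suc zero)}   e = ⊥-elim (uw e)
  injective {suc zero}         {suc (suc zero)}   e = ⊥-elim (vw e)
  injective {suc zero}         {zero}             e = ⊥-elim (uv (sym e))
  injective {suc (suc zero)}   {zero}             e = ⊥-elim (uw (sym e))
  injective {suc (suc zero)}   {suc zero}         e = ⊥-elim (vw (sym e))

-- C₅ is an odd cycle: if 0, 1, 2 do not already carry three colours then f 0 = f 2,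
-- and similarly with 0, 1, 3 and then 0, 1, 4.
C₅-forces : ForcesColours C₅ 3
C₅-forces f f-proper with f (# 0) ≟ f (# 2)
... | no f₀≢f₂ = rainbow₃ f (f-proper (# 0) (# 1) refl) f₀≢f₂ (f-proper (# 1) (# 2) refl)
... | yes f₀≡f₂ with f (# 1) ≟ f (# 3)
...   | no f₁≢f₃ =
  rainbow₃ f (f-proper (# 0) (# 1) refl) (f-proper (# 2) (# 3) refl ∘ trans (sym f₀≡f₂)) f₁≢f₃
...   | yes f₁≡f₃ =
  rainbow₃ f (f-proper (# 0) (# 1) refl) (f-proper (# 0) (# 4) refl)
    (f-proper (# 3) (# 4) refl ∘ trans (sym f₁≡f₃))

corollary1 : ∀ (k : ℕ) → 1 ≤ k →
    Σ Graph (λ G → IsSphere G (2 * k ∸ 1) × ChromaticNumber G (3 * k))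
    × Σ Graph (λ G → IsSphere G (2 * k) × ChromaticNumber G (3 * k + 1))
corollary1 k@(suc _) _ =
  (C₅ ⋆^ k , odd-sphere , odd-χ) , (S⁰ ⋆ (C₅ ⋆^ k) , even-sphere , even-χ)
  where
  -- As k = suc _, IsSphere G (2 * k ∸ 1) unfolds to Sphere′ G (2 * k) ⊤.
  odd-sphere : Sphere′ (C₅ ⋆^ k) (2 * k) ⊤
  odd-sphere = subst (λ d → Sphere′ (C₅ ⋆^ k) d ⊤) (*-comm k 2) (Sphere′-⋆^ k C₅-sphere)

  odd-χ : ChromaticNumber (C₅ ⋆^ k) (3 * k)
  odd-χ = subst (ChromaticNumber (C₅ ⋆^ k)) (*-comm k 3)
    (ChromaticNumber-⋆^ k C₅-colourable C₅-forces)

  even-sphere : Sphere′ (S⁰ ⋆ (C₅ ⋆^ k)) (1 + 2 * k) ⊤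
  even-sphere = subst (λ d → Sphere′ (S⁰ ⋆ (C₅ ⋆^ k)) (1 + d) ⊤) (*-comm k 2)
    (Sphere′-⋆ S⁰ (C₅ ⋆^ k) S⁰-sphere (Sphere′-⋆^ k C₅-sphere))

  even-χ : ChromaticNumber (S⁰ ⋆ (C₅ ⋆^ k)) (3 * k + 1)
  even-χ = subst (ChromaticNumber (S⁰ ⋆ (C₅ ⋆^ k)))
    (trans (cong suc (*-comm k 3)) (+-comm 1 (3 * k)))
    (ChromaticNumber-⋆ S⁰ (C₅ ⋆^ k) S⁰-colourable S⁰-forces
      (ChromaticNumber-⋆^ k C₅-colourable C₅-forces))
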